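{- Let $G$ be a connected graph with at least $2$ vertices such that $G^{2}$ is a König–Egerváry graph. Then $G$ is square-stable if and only if $G$ is a König–Egerváry graph having a perfect matching.
   Context: All graphs are finite and simple. $\alpha(G)$ is the maximum size of a stable set (set of pairwise non-adjacent vertices) and $\mu(G)$ the maximum size of a matching. $G$ is a König–Egerváry graph if $\alpha(G)+\mu(G)=|V(G)|$. $G^{2}$ is the graph on $V(G)$ in which distinct $u,v$ are adjacent iff $dist_G(u,v)\le 2$; $G$ is square-stable if $\alpha(G)=\alpha(G^{2})$. -}

module Defs where

open import Data.Nat using (ℕ; suc; _≤_; _+_; _*_)
open import Data.Fin using (Fin)
open import Data.Product using (Σ; _×_; _,_; ∃)
open import Data.Sum using (_⊎_)
open import Data.List using (List; length; []; _∷_)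
open import Data.List.Relation.Unary.AllPairs using (AllPairs)
open import Data.List.Relation.Unary.All using (All)
open import Data.List.Relation.Unary.Any using (Any)
open import Relation.Nullary using (¬_)
open import Relation.Binary.PropositionalEquality using (_≡_; _≢_)

record Graph (n : ℕ) : Set₁ where
  field
    Adj     : Fin n → Fin n → Set
    sym     : ∀ {u v} → Adj u v → Adj v u
    irrefl  : ∀ {u} → ¬ Adj u u
open Graph public

SqAdj : ∀ {n} → Graph n → Fin n → Fin n → Set
SqAdj G u v = (u ≢ v) × (Adj G u v ⊎ ∃ λ w → Adj G u w × Adj G w v)

square : ∀ {n} → Graph n → Graph n
square G = record
  { Adj = SqAdj G
  ; sym = λ { (u≢v , _⊎_.inj₁ a) → (λ e → u≢v (symm e)) , _⊎_.inj₁ (Graph.sym G a)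
            ; (u≢v , _⊎_.inj₂ (w , a , b)) → (λ e → u≢v (symm e)) , _⊎_.inj₂ (w , Graph.sym G b , Graph.sym G a) }
  ; irrefl = λ { (u≢u , _) → u≢u _≡_.refl }
  }
  where
  open import Relation.Binary.PropositionalEquality using () renaming (sym to symm)

IsStable : ∀ {n} → Graph n → List (Fin n) → Set
IsStable G S = AllPairs (λ u v → (u ≢ v) × ¬ Adj G u v) S

IsAlpha : ∀ {n} → Graph n → ℕ → Set
IsAlpha G k = (Σ (List _) λ S → IsStable G S × length S ≡ k)
            × (∀ S → IsStable G S → length S ≤ k)

Edge : ∀ {n} → Graph n → Set
Edge {n} G = Σ (Fin n) λ u → Σ (Fin n) λ v → Adj G u v

Disjoint : ∀ {n} {G : Graph n} → Edge G → Edge G → Set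
Disjoint (u , v , _) (u' , v' , _) = (u ≢ u') × (u ≢ v') × (v ≢ u') × (v ≢ v')

IsMatching : ∀ {n} → (G : Graph n) → List (Edge G) → Set
IsMatching G M = AllPairs (Disjoint {G = G}) M

IsMu : ∀ {n} → Graph n → ℕ → Set
IsMu G k = (Σ (List _) λ M → IsMatching G M × length M ≡ k)
         × (∀ M → IsMatching G M → length M ≤ k)

IsKE : ∀ {n} → Graph n → Set
IsKE {n} G = ∀ a m → IsAlpha G a → IsMu G m → a + m ≡ n

SquareStable : ∀ {n} → Graph n → Set
SquareStable G = ∀ a b → IsAlpha G a → IsAlpha (square G) b → a ≡ b

Covers : ∀ {n} {G : Graph n} → List (Edge G) → Fin n → Set
Covers M x = Any (λ { (u , v , _) → (x ≡ u) ⊎ (x ≡ v) }) M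

HasPerfectMatching : ∀ {n} → Graph n → Set
HasPerfectMatching {n} G = Σ (List (Edge G)) λ M → IsMatching G M × (∀ x → Covers {G = G} M x)

data Walk {n} (G : Graph n) : Fin n → Fin n → Set where
  here : ∀ {u} → Walk G u u
  step : ∀ {u v w} → Adj G u v → Walk G v w → Walk G u w

Connected : ∀ {n} → Graph n → Set
Connected G = ∀ u v → Walk G u v

module Submission where

-- Fix a neighbour f(v) of every vertex v.  For S stable in G² the edges v f(v), v ∈ S, are pairwise
-- disjoint, so α(G²) ≤ μ(G) ≤ μ(G²), while 2μ(G²) ≤ n.  Since α(G²) + μ(G²) = n, this forces
-- α(G²) = μ(G) = n/2: G always has a perfect matching, and α(G) = α(G²) says exactly α(G) + μ(G) = n.
-- Constructively the maximum sizes exist only under double negation, which can be discharged because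
-- every goal is an equation of naturals or, for the perfect matching, a decidable search.

open import Defs hiding (sym)
open import Data.Nat using (ℕ; zero; suc; _+_; _≤_; _<_; z≤n; s≤s)
open import Data.Nat.Properties
  using (_≟_; _≤?_; ≤-trans; ≤-antisym; ≮⇒≥; ≰⇒>; <-≤-trans; n≮n; m≤m+n; +-suc;
         +-monoʳ-≤; +-mono-<; +-cancelʳ-≡; +-cancelʳ-≤)
open import Data.Fin using (Fin; zero; suc)
import Data.Fin as Fin
open import Data.Fin.Properties using (pigeonhole) renaming (_≟_ to _≟ᶠ_; any? to anyᶠ?)
open import Data.List using (List; []; _∷_; length; lookup; map)
open import Data.List.Properties using (length-map)
open import Data.List.Relation.Unary.All using (All; []; _∷_)
open import Data.List.Relation.Unary.All.Properties.Core using (¬Any⇒All¬)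
open import Data.List.Relation.Unary.AllPairs using ([]; _∷_; allPairs?)
import Data.List.Relation.Unary.AllPairs as AllPairs
import Data.List.Relation.Unary.AllPairs.Properties as AllPairs
open import Data.List.Relation.Unary.Any using (here; there)
open import Data.List.Relation.Unary.Unique.Propositional using (Unique)
open import Data.List.Membership.Propositional using (_∈_)
open import Data.Product using (Σ; ∃; _×_; _,_; proj₁; proj₂)
open import Data.Sum using (inj₁; inj₂)
open import Effect.Monad using (RawMonad)
open import Function using (case_of_)
open import Function.Bundles using (_⇔_; mk⇔)
open import Level using (0ℓ)
open import Relation.Binary.PropositionalEquality using (_≡_; _≢_; refl; sym; trans; subst; cong; cong₂; module ≡-Reasoning)
open import Relation.Nullary using (¬_; Dec; yes; no; ¬?; contradiction)
open import Relation.Nullary.Decidable using (decidable-stable; ¬¬-excluded-middle; _×-dec_)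
open import Relation.Nullary.Negation using (¬¬-Monad)
open import Relation.Unary using (Decidable)

open RawMonad (¬¬-Monad {0ℓ})

module _ {n : ℕ} where
  open import Data.List.Membership.DecPropositional (_≟ᶠ_ {n}) using (_∈?_)

  Unique⇒length≤ : ∀ {xs : List (Fin n)} → Unique xs → length xs ≤ n
  Unique⇒length≤ {xs} u with length xs ≤? n
  ... | yes ≤n = ≤n
  ... | no ≰n with i , j , i<j , eq ← pigeonhole (≰⇒> ≰n) (lookup xs) = contradiction eq (lookup-distinct u i<j)
    where
    lookup-distinct : ∀ {ys : List (Fin n)} → Unique ys → ∀ {i j} → i Fin.< j → lookup ys i ≢ lookup ys j
    lookup-distinct (y≢ ∷ _) {zero} {suc j} _ = ≢-lookup y≢ j
      where
      ≢-lookup : ∀ {y} {zs : List (Fin n)} → All (y ≢_) zs → ∀ k → y ≢ lookup zs k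
      ≢-lookup (y≢z ∷ _) zero = y≢z
      ≢-lookup (_ ∷ y≢zs) (suc k) = ≢-lookup y≢zs k
    lookup-distinct (_ ∷ u) {suc i} {suc j} (s≤s i<j) = lookup-distinct u i<j

  ∃-list? : {P : List (Fin n) → Set} → Decidable P → ∀ k → Dec (∃ λ xs → length xs ≤ k × P xs)
  ∃-list? P? zero with P? []
  ... | yes p[] = yes ([] , z≤n , p[])
  ... | no ¬p[] = no λ { ([] , _ , p[]) → ¬p[] p[] }
  ∃-list? P? (suc k) with P? [] | anyᶠ? (λ x → ∃-list? (λ xs → P? (x ∷ xs)) k)
  ... | yes p[] | _ = yes ([] , z≤n , p[])
  ... | no _ | yes (x , xs , len , pxs) = yes (x ∷ xs , s≤s len , pxs)
  ... | no ¬p[] | no ¬cons = no λ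
    { ([] , _ , p[]) → ¬p[] p[]
    ; (x ∷ xs , s≤s len , pxs) → ¬cons (x , xs , len , pxs) }

  Unique∧length≡⇒∈ : ∀ {xs : List (Fin n)} → Unique xs → length xs ≡ n → ∀ x → x ∈ xs
  Unique∧length≡⇒∈ {xs} u len x with x ∈? xs
  ... | yes x∈xs = x∈xs
  ... | no x∉xs =
    contradiction (subst (λ k → suc k ≤ n) len (Unique⇒length≤ {xs = x ∷ xs} (¬Any⇒All¬ xs x∉xs ∷ u))) (n≮n n)

m+m≤n+n⇒m≤n : ∀ {m n} → m + m ≤ n + n → m ≤ n
m+m≤n+n⇒m≤n m+m≤n+n = ≮⇒≥ λ n<m → n≮n _ (<-≤-trans (+-mono-< n<m n<m) m+m≤n+n)

¬¬-maximum : ∀ {Q : ℕ → Set} {N k} → Q k → (∀ j → Q j → j ≤ N)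
           → ¬ ¬ (∃ λ m → Q m × (∀ j → Q j → j ≤ m))
¬¬-maximum {Q} {N} {k} qk bounded = climb N qk (m≤m+n N k)
  where
  climb : ∀ fuel {k} → Q k → N ≤ fuel + k → ¬ ¬ (∃ λ m → Q m × (∀ j → Q j → j ≤ m))
  climb zero {k} qk N≤k = pure (k , qk , λ j qj → ≤-trans (bounded j qj) N≤k)
  climb (suc fuel) {k} qk N≤1+fuel+k = do
    larger? ← ¬¬-excluded-middle {A = ∃ λ j → Q j × k < j}
    case larger? of λ
      { (yes (j , qj , k<j)) →
          climb fuel qj (≤-trans N≤1+fuel+k (subst (_≤ fuel + j) (+-suc fuel k) (+-monoʳ-≤ fuel k<j)))
      ; (no none) → pure (k , qk , λ j qj → ≮⇒≥ λ k<j → none (j , qj , k<j)) }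

-- IsAlpha G and IsMu G are definitionally MaxLength (IsStable G) and MaxLength (IsMatching G).
MaxLength : {A : Set} → (List A → Set) → ℕ → Set
MaxLength {A} P k = (Σ (List A) λ xs → P xs × length xs ≡ k) × (∀ xs → P xs → length xs ≤ k)

MaxLength-unique : ∀ {A : Set} {P : List A → Set} {k l} → MaxLength P k → MaxLength P l → k ≡ l
MaxLength-unique ((xs , pxs , refl) , ≤k) ((ys , pys , refl) , ≤l) = ≤-antisym (≤l xs pxs) (≤k ys pys)

¬¬-MaxLength : ∀ {A : Set} {P : List A → Set} {N} → P [] → (∀ xs → P xs → length xs ≤ N)
             → ¬ ¬ ∃ (MaxLength P)
¬¬-MaxLength {P = P} p[] bounded = do
  m , (xs , pxs , len) , maximal ← ¬¬-maximum {Q = λ k → ∃ λ xs → P xs × length xs ≡ k} ([] , p[] , refl)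
                                     (λ { j (xs , pxs , refl) → bounded xs pxs })
  pure (m , (xs , pxs , len) , λ ys pys → maximal (length ys) (ys , pys , refl))

module _ {n} (G : Graph n) where

  Stable⇒Unique : ∀ {S} → IsStable G S → Unique S
  Stable⇒Unique = AllPairs.map proj₁

  ¬¬-alpha : ¬ ¬ ∃ (IsAlpha G)
  ¬¬-alpha = ¬¬-MaxLength [] (λ S st → Unique⇒length≤ (Stable⇒Unique st))

  endpoints : List (Edge G) → List (Fin n)
  endpoints [] = []
  endpoints ((u , v , _) ∷ M) = u ∷ v ∷ endpoints M

  length-endpoints : ∀ M → length (endpoints M) ≡ length M + length M
  length-endpoints [] = refl
  length-endpoints (_ ∷ M) = cong suc (trans (cong suc (length-endpoints M)) (sym (+-suc (length M) (length M))))

  ∈-endpoints⇒Covers : ∀ {x} M → x ∈ endpoints M → Covers {G = G} M x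
  ∈-endpoints⇒Covers (_ ∷ _) (here x≡u) = here (inj₁ x≡u)
  ∈-endpoints⇒Covers (_ ∷ _) (there (here x≡v)) = here (inj₂ x≡v)
  ∈-endpoints⇒Covers (_ ∷ M) (there (there x∈M)) = there (∈-endpoints⇒Covers M x∈M)

  Matching⇒Unique-endpoints : ∀ {M} → IsMatching G M → Unique (endpoints M)
  Matching⇒Unique-endpoints {[]} [] = []
  Matching⇒Unique-endpoints {(u , v , uv) ∷ M} (disjoint ∷ matching) =
    (u≢v ∷ proj₁ (avoids disjoint)) ∷ proj₂ (avoids disjoint) ∷ Matching⇒Unique-endpoints matching
    where
    u≢v : u ≢ v
    u≢v refl = irrefl G uv
    avoids : ∀ {M} → All (Disjoint {G = G} (u , v , uv)) M → All (u ≢_) (endpoints M) × All (v ≢_) (endpoints M)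
    avoids [] = [] , []
    avoids ((u≢u′ , u≢v′ , v≢u′ , v≢v′) ∷ disjoint) =
      (u≢u′ ∷ u≢v′ ∷ proj₁ (avoids disjoint)) , (v≢u′ ∷ v≢v′ ∷ proj₂ (avoids disjoint))

  Matching⇒length+length≤ : ∀ {M} → IsMatching G M → length M + length M ≤ n
  Matching⇒length+length≤ {M} matching =
    subst (_≤ n) (length-endpoints M) (Unique⇒length≤ (Matching⇒Unique-endpoints matching))

  Matching∧length+length≡⇒perfect : ∀ {M} → IsMatching G M → length M + length M ≡ n → HasPerfectMatching G
  Matching∧length+length≡⇒perfect {M} matching len = M , matching , λ x →
    ∈-endpoints⇒Covers M (Unique∧length≡⇒∈ (Matching⇒Unique-endpoints matching) (trans (length-endpoints M) len) x)

  ¬¬-mu : ¬ ¬ ∃ (IsMu G)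
  ¬¬-mu = ¬¬-MaxLength [] (λ M matching → ≤-trans (m≤m+n _ _) (Matching⇒length+length≤ matching))

  Disjoint? : (e f : Edge G) → Dec (Disjoint {G = G} e f)
  Disjoint? (u , v , _) (u′ , v′ , _) = ¬? (u ≟ᶠ u′) ×-dec ¬? (u ≟ᶠ v′) ×-dec ¬? (v ≟ᶠ u′) ×-dec ¬? (v ≟ᶠ v′)

  Edge⇒square-Edge : Edge G → Edge (square G)
  Edge⇒square-Edge (u , v , uv) = u , v , (λ { refl → irrefl G uv }) , inj₁ uv

  Matching⇒square-Matching : ∀ {M} → IsMatching G M → IsMatching (square G) (map Edge⇒square-Edge M)
  Matching⇒square-Matching = AllPairs.map⁺

NoIsolatedVertex : ∀ {n} → Graph n → Set
NoIsolatedVertex {n} G = (v : Fin n) → ∃ (Adj G v)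

connected⇒NoIsolatedVertex : ∀ {n} {G : Graph n} → 2 ≤ n → Connected G → NoIsolatedVertex G
connected⇒NoIsolatedVertex {G = G} (s≤s (s≤s _)) connected v = firstEdge (connected v (other v)) (≢-other v)
  where
  other : ∀ {m} → Fin (suc (suc m)) → Fin (suc (suc m))
  other zero = suc zero
  other (suc _) = zero
  ≢-other : ∀ {m} (v : Fin (suc (suc m))) → v ≢ other v
  ≢-other zero ()
  ≢-other (suc _) ()
  firstEdge : ∀ {u w} → Walk G u w → u ≢ w → ∃ (Adj G u)
  firstEdge here u≢u = contradiction refl u≢u
  firstEdge (step uv _) _ = _ , uv

module _ {n} (G : Graph n) (neighbour : NoIsolatedVertex G) where

  pendant : Fin n → Edge G
  pendant v = v , neighbour v

  pendants-disjoint : ∀ {s t} → s ≢ t → ¬ SqAdj G s t → Disjoint {G = G} (pendant s) (pendant t)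
  pendants-disjoint {s} {t} s≢t ¬st = s≢t , s≢t′ , s′≢t , s′≢t′
    where
    s′ = proj₁ (neighbour s)
    t′ = proj₁ (neighbour t)
    s≢t′ : s ≢ t′
    s≢t′ s≡t′ = ¬st (s≢t , inj₁ (Graph.sym G (subst (Adj G t) (sym s≡t′) (proj₂ (neighbour t)))))
    s′≢t : s′ ≢ t
    s′≢t s′≡t = ¬st (s≢t , inj₁ (subst (Adj G s) s′≡t (proj₂ (neighbour s))))
    s′≢t′ : s′ ≢ t′
    s′≢t′ s′≡t′ =
      ¬st (s≢t , inj₂ (s′ , proj₂ (neighbour s) , Graph.sym G (subst (Adj G t) (sym s′≡t′) (proj₂ (neighbour t)))))

  Stable-square⇒pendant-Matching : ∀ {S} → IsStable (square G) S → IsMatching G (map pendant S)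
  Stable-square⇒pendant-Matching stable =
    AllPairs.map⁺ (AllPairs.map (λ (s≢t , ¬st) → pendants-disjoint s≢t ¬st) stable)

module _ {n} (G : Graph n) (neighbour : NoIsolatedVertex G) (square-KE : IsKE (square G)) where

  alpha-square-half : ∀ {b} → IsAlpha (square G) b → b + b ≡ n
  alpha-square-half {b} α@((S , stable , refl) , _) = decidable-stable (b + b ≟ n) do
    m , μ@((M , matching , refl) , maximal) ← ¬¬-mu (square G)
    let b+m≡n : b + m ≡ n
        b+m≡n = square-KE b m α μ
        b≤m : b ≤ m
        b≤m = subst (_≤ m) (trans (length-map (Edge⇒square-Edge G) pendants) (length-map (pendant G neighbour) S))
                (maximal _ (Matching⇒square-Matching G (Stable-square⇒pendant-Matching G neighbour stable)))
        m≤b : m ≤ b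
        m≤b = +-cancelʳ-≤ m m b (subst (m + m ≤_) (sym b+m≡n) (Matching⇒length+length≤ (square G) matching))
    pure (subst (λ k → b + k ≡ n) (sym (≤-antisym b≤m m≤b)) b+m≡n)
    where
    pendants = map (pendant G neighbour) S

  alpha-square⇒mu : ∀ {b} → IsAlpha (square G) b → IsMu G b
  alpha-square⇒mu α@((S , stable , refl) , _) =
      (map (pendant G neighbour) S , Stable-square⇒pendant-Matching G neighbour stable , length-map _ S)
    , λ M matching → m+m≤n+n⇒m≤n
        (subst (length M + length M ≤_) (sym (alpha-square-half α)) (Matching⇒length+length≤ G matching))

  perfectMatching : HasPerfectMatching G
  perfectMatching = fromHalf (decidable-stable (∃-list? HalfPendantMatching? n) ¬¬halfPendantMatching)
    where
    -- Adjacency is not decidable, so we search among pendant edges of vertex lists, not among edges.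
    HalfPendantMatching : List (Fin n) → Set
    HalfPendantMatching S = IsMatching G (map (pendant G neighbour) S) × length S + length S ≡ n

    HalfPendantMatching? : Decidable HalfPendantMatching
    HalfPendantMatching? S = allPairs? (Disjoint? G) (map (pendant G neighbour) S) ×-dec (length S + length S ≟ n)

    ¬¬halfPendantMatching : ¬ ¬ ∃ λ S → length S ≤ n × HalfPendantMatching S
    ¬¬halfPendantMatching = do
      _ , α@((S , stable , refl) , _) ← ¬¬-alpha (square G)
      pure (S , Unique⇒length≤ (Stable⇒Unique (square G) stable) ,
            Stable-square⇒pendant-Matching G neighbour stable , alpha-square-half α)

    fromHalf : (∃ λ S → length S ≤ n × HalfPendantMatching S) → HasPerfectMatching G
    fromHalf (S , _ , matching , half) =
      Matching∧length+length≡⇒perfect G matching (subst (λ k → k + k ≡ n) (sym (length-map _ S)) half)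

  squareStable⇒KE : SquareStable G → IsKE G
  squareStable⇒KE square-stable a m α μ = decidable-stable (a + m ≟ n) do
    b , αsq ← ¬¬-alpha (square G)
    pure (begin
      a + m  ≡⟨ cong₂ _+_ (square-stable a b α αsq) (MaxLength-unique μ (alpha-square⇒mu αsq)) ⟩
      b + b  ≡⟨ alpha-square-half αsq ⟩
      n      ∎)
    where open ≡-Reasoning

  KE⇒squareStable : IsKE G → SquareStable G
  KE⇒squareStable KE a b α αsq =
    +-cancelʳ-≡ b a b (trans (KE a b α (alpha-square⇒mu αsq)) (sym (alpha-square-half αsq)))

proposition3 : ∀ (n : ℕ) (G : Graph n) → 2 ≤ n → Connected G → IsKE (square G)
    → SquareStable G ⇔ (IsKE G × HasPerfectMatching G)
proposition3 n G 2≤n connected square-KE = mk⇔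
  (λ square-stable → squareStable⇒KE G neighbour square-KE square-stable , perfectMatching G neighbour square-KE)
  (λ (KE , _) → KE⇒squareStable G neighbour square-KE KE)
  where
  neighbour : NoIsolatedVertex G
  neighbour = connected⇒NoIsolatedVertex 2≤n connected
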